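{- Let $n,k,\ell$ be integers with $1\le k\le n$ and $\ell \ge 0$. There exist algorithms that solve the $\ell$-bounded error partition learning problem on $V=[n]$ (hidden partition into $k$ clusters) making at most $$ (\ell+1)\left(n(k-1) - \binom{k}{2}\right) + \ell $$ queries in the worst case when $k$ is known to the algorithm, and at most $$ (\ell+1)\left(nk - \binom{k+1}{2}\right) + \ell $$ queries in the worst case when $k$ is unknown.
   Context: Given a partition $\mathcal{C}$ of a finite set $V$, the same-cluster oracle $\alpha_{\mathcal{C}}$ takes a pair $\{u,v\}$ of distinct elements of $V$ and returns $1$ if $u,v$ lie in the same cluster of $\mathcal{C}$ and $-1$ otherwise. An $\ell$-faulty same-cluster oracle may return an incorrect answer on at most $\ell$ of the queries made over the whole run; errors may be chosen adversarially and are not persistent. The $\ell$-bounded error partition learning problem is: given $V$ and access to an $\ell$-faulty same-cluster oracle for an unknown partition $\mathcal{C}$ of $V$ into $k$ nonempty clusters, always exactly recover $\mathcal{C}$ (adaptive queries allowed). -}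

module Defs where

open import Data.Nat using (ℕ; zero; suc)
open import Data.Fin using (Fin; _≟_)
open import Data.Bool using (Bool; true; false; not)
open import Data.Product using (_×_)
open import Data.Unit using (⊤)
open import Data.Empty using (⊥)
open import Function using (Surjective; _⇔_)
open import Relation.Nullary using (¬_)
open import Relation.Nullary.Decidable using (⌊_⌋)
open import Relation.Binary.PropositionalEquality using (_≡_)

-- A (deterministic, adaptive) query algorithm on V = Fin n, as a decision tree.
-- It either outputs a partition of V (encoded as a labelling Fin n → Fin n, two
-- elements being in the same cluster iff they get the same label), or asks the
-- oracle about a pair {u,v} of distinct elements and continues depending on the
-- answer (true = "same cluster" = 1, false = -1).
data Alg (n : ℕ) : Set where
  done : (Fin n → Fin n) → Alg n
  ask  : (u v : Fin n) → ¬ (u ≡ v) → (Bool → Alg n) → Alg n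

-- A hidden partition of V = Fin n into exactly k nonempty clusters is given by a
-- surjective labelling c : Fin n → Fin k.
IsPartitionInto : (n k : ℕ) → (Fin n → Fin k) → Set
IsPartitionInto n k c = Surjective _≡_ _≡_ c

oracle : {n k : ℕ} → (Fin n → Fin k) → Fin n → Fin n → Bool
oracle c u v = ⌊ c u ≟ c v ⌋

Recovers : {n k : ℕ} → (Fin n → Fin k) → (Fin n → Fin n) → Set
Recovers c f = ∀ u v → (f u ≡ f v) ⇔ (c u ≡ c v)

-- Solves c e q A : against every adversarial (adaptive, non-persistent) behaviour
-- of the faulty oracle that may still lie at most e more times, algorithm A makes
-- at most q further queries and then outputs exactly the partition given by c.
Solves : {n k : ℕ} → (Fin n → Fin k) → ℕ → ℕ → Alg n → Set
Solves c e q (done f) = Recovers c f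
Solves c e zero (ask u v _ next) = ⊥
Solves c zero (suc q) (ask u v _ next) =
  Solves c zero q (next (oracle c u v))
Solves c (suc e) (suc q) (ask u v _ next) =
  Solves c (suc e) q (next (oracle c u v)) × Solves c e q (next (not (oracle c u v)))

module Submission where

-- Without errors, process the elements in order, keeping one representative per
-- cluster found so far: a new element is compared with the representatives until
-- one matches, and once all k clusters are known (k given) the last comparison is
-- skipped. The i-th element then costs at most min(i, D) queries, with D = k - 1
-- if k is known and D = k otherwise, and Σ_{i<n} min(i, D) = nD - C(D+1, 2).
-- Lies are absorbed by repeating each query until one answer has occurred r + 1
-- times, r bounding the lies still possible: every minority answer is a lie, so r
-- drops by their number, and P queries cost at most (r + 1) P + r in total.

open import Defs
open import Data.Nat using (ℕ; _+_; _*_; _∸_; _≤_)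
open import Data.Nat.Combinatorics using (_C_)
open import Data.Fin using (Fin)
open import Data.Product using (_×_; ∃-syntax)

open import Data.Bool using (Bool; true; false; T; if_then_else_)
open import Data.Fin.Properties using (injective⇒≤)
import Data.Fin as Fin
open import Data.List using (List; []; _∷_; length; lookup; allFin)
open import Data.List.Membership.Propositional using (_∈_)
open import Data.List.Membership.Propositional.Properties using (∈-lookup; ∈-allFin)
open import Data.List.Properties using (length-tabulate)
open import Data.List.Relation.Binary.Subset.Propositional using (_⊆_)
open import Data.List.Relation.Unary.All as All using (All; []; _∷_)
open import Data.List.Relation.Unary.All.Properties using (¬Any⇒All¬)
open import Data.List.Relation.Unary.Any.Properties using (singleton⁻)
open import Data.List.Relation.Unary.AllPairs using (AllPairs; []; _∷_)
open import Data.List.Relation.Unary.Any as Any using (Any; here; there; any?)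
open import Data.Maybe using (Maybe; just; nothing; maybe′)
open import Data.Nat using (zero; suc; z≤n; s≤s; _⊓_; _≟_)
open import Data.Nat.Combinatorics using (nC1≡n; nCk+nC[k+1]≡[n+1]C[k+1])
open import Data.Nat.Properties
  using (≤-refl; ≤-trans; ≤-pred; ≤∧≢⇒<; n≤1+n; m≤n⇒m≤1+n; 1+n≰n; m≤m+n; m≤n+m;
         +-assoc; +-comm; +-suc; +-identityʳ; +-monoˡ-≤; +-monoʳ-≤; *-distribʳ-+;
         m∸n≤m; m+n∸n≡m; m+[n∸m]≡n; ⊓-glb; m≤n⇒m⊓n≡m; m≥n⇒m⊓n≡n)
open import Data.Nat.Tactic.RingSolver using (solve-∀)
open import Data.Product using (_,_)
open import Data.Sum using (_⊎_; inj₁; inj₂; [_,_]′)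
open import Data.Vec.Functional using (updateAt)
open import Data.Vec.Functional.Properties using (updateAt-updates; updateAt-minimal)
open import Function using (_∘_; id; const; Injective; mk⇔)
open import Relation.Nullary using (yes; no; contradiction)
open import Relation.Nullary.Decidable using (⌊_⌋; toWitness)
open import Relation.Binary.PropositionalEquality
  using (_≡_; _≢_; refl; sym; trans; cong; cong₂; subst; module ≡-Reasoning)

Solves-mono : ∀ {n k} (c : Fin n → Fin k) (A : Alg n) {e q q′} →
              q ≤ q′ → Solves c e q A → Solves c e q′ A
Solves-mono c (done f)         _                          s = s
Solves-mono c (ask u v _ next) {e}     {zero}             _ ()
Solves-mono c (ask u v _ next) {zero}  {suc q} {suc q′} (s≤s q≤q′) s =
  Solves-mono c (next _) q≤q′ s
Solves-mono c (ask u v _ next) {suc e} {suc q} {suc q′} (s≤s q≤q′) (s₁ , s₂) =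
  Solves-mono c (next _) q≤q′ s₁ , Solves-mono c (next _) q≤q′ s₂

-- vote x y k asks {u,v} until it has received x + 1 answers "same" or y + 1
-- answers "different", and passes that answer to k together with what remains of
-- the losing answer's counter, which bounds the number of lies still possible.
module Vote {n : ℕ} (u v : Fin n) (u≢v : u ≢ v) where
  mutual
    vote : ℕ → ℕ → (Bool → ℕ → Alg n) → Alg n
    vote x y k = ask u v u≢v (λ b → tally b x y k)

    tally : Bool → ℕ → ℕ → (Bool → ℕ → Alg n) → Alg n
    tally true  zero    y       k = k true y
    tally true  (suc x) y       k = vote x y k
    tally false x       zero    k = k false x
    tally false x       (suc y) k = vote x y k

robust : ∀ {n} → ℕ → Alg n → Alg n
robust r (done g)           = done g
robust r (ask u v u≢v next) = Vote.vote u v u≢v r r (λ b r′ → robust r′ (next b))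

module VoteSolves {n k} (c : Fin n → Fin k) (u v : Fin n) (u≢v : u ≢ v)
  (K : Bool → ℕ → Alg n) (G : ℕ → ℕ) (G-step : ∀ y → suc (G y) ≤ G (suc y)) where
  open Vote u v u≢v

  vote-budget-step : ∀ x y → suc (x + G y) ≤ x + G (suc y)
  vote-budget-step x y = subst (_≤ x + G (suc y)) (+-suc x (G y)) (+-monoʳ-≤ x (G-step y))

  module _ (truth : oracle c u v ≡ true)
           (K-solves : ∀ y e → e ≤ y → Solves c e (G y) (K true y)) where
    mutual
      vote-true : ∀ x y e → e ≤ y → Solves c e (suc (x + G y)) (vote x y K)
      vote-true x y zero _ rewrite truth = tally-true x y zero z≤n
      vote-true x (suc y) (suc e) (s≤s e≤y) rewrite truth =
        tally-true x (suc y) (suc e) (s≤s e≤y) ,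
        Solves-mono c (vote x y K) (vote-budget-step x y) (vote-true x y e e≤y)

      tally-true : ∀ x y e → e ≤ y → Solves c e (x + G y) (tally true x y K)
      tally-true zero    y e e≤y = K-solves y e e≤y
      tally-true (suc x) y e e≤y = vote-true x y e e≤y

  module _ (truth : oracle c u v ≡ false)
           (K-solves : ∀ x e → e ≤ x → Solves c e (G x) (K false x)) where
    mutual
      vote-false : ∀ x y e → e ≤ x → Solves c e (suc (y + G x)) (vote x y K)
      vote-false x y zero _ rewrite truth = tally-false x y zero z≤n
      vote-false (suc x) y (suc e) (s≤s e≤x) rewrite truth =
        tally-false (suc x) y (suc e) (s≤s e≤x) ,
        Solves-mono c (vote x y K) (vote-budget-step y x) (vote-false x y e e≤x)

      tally-false : ∀ x y e → e ≤ x → Solves c e (y + G x) (tally false x y K)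
      tally-false x zero    e e≤x = K-solves x e e≤x
      tally-false x (suc y) e e≤x = vote-false x y e e≤x

robustCost : ℕ → ℕ → ℕ
robustCost P r = (r + 1) * P + r

module _ {n k} (c : Fin n → Fin k) where
  open VoteSolves c

  private
    robustCost-step : ∀ P r → suc (robustCost P r) ≤ robustCost P (suc r)
    robustCost-step P r = subst (suc (robustCost P r) ≤_) (sym (unfold P r)) (m≤n+m _ P)
      where
      unfold : ∀ P r → (suc r + 1) * P + suc r ≡ P + suc ((r + 1) * P + r)
      unfold = solve-∀

    robustCost-suc : ∀ P r → suc (r + ((r + 1) * P + r)) ≡ (r + 1) * suc P + r
    robustCost-suc = solve-∀

  robust-solves : ∀ (A : Alg n) P r e → Solves c zero P A → e ≤ r →
                  Solves c e (robustCost P r) (robust r A)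
  robust-solves (done g) P r e s _ = s
  robust-solves (ask u v u≢v next) (suc P) r e s e≤r with oracle c u v in truth
  ... | true  = subst (λ q → Solves c e q (robust r (ask u v u≢v next))) (robustCost-suc P r)
      (vote-true u v u≢v (λ b r′ → robust r′ (next b)) (robustCost P) (robustCost-step P)
        truth (λ y e′ → robust-solves (next true) P y e′ s) r r e e≤r)
  ... | false = subst (λ q → Solves c e q (robust r (ask u v u≢v next))) (robustCost-suc P r)
      (vote-false u v u≢v (λ b r′ → robust r′ (next b)) (robustCost P) (robustCost-step P)
        truth (λ x e′ → robust-solves (next false) P x e′ s) r r e e≤r)

sumMin : ℕ → ℕ → ℕ → ℕ
sumMin D i zero    = zero
sumMin D i (suc p) = i ⊓ D + sumMin D (suc i) p

sumMin-+ : ∀ D i p q → sumMin D i (p + q) ≡ sumMin D i p + sumMin D (i + p) q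
sumMin-+ D i zero    q = cong (λ j → sumMin D j q) (sym (+-identityʳ i))
sumMin-+ D i (suc p) q = begin
  i ⊓ D + sumMin D (suc i) (p + q)                        ≡⟨ cong (i ⊓ D +_) (sumMin-+ D (suc i) p q) ⟩
  i ⊓ D + (sumMin D (suc i) p + sumMin D (suc i + p) q)   ≡⟨ sym (+-assoc (i ⊓ D) _ _) ⟩
  i ⊓ D + sumMin D (suc i) p + sumMin D (suc (i + p)) q   ≡⟨ cong (λ j → i ⊓ D + sumMin D (suc i) p + sumMin D j q) (sym (+-suc i p)) ⟩
  i ⊓ D + sumMin D (suc i) p + sumMin D (i + suc p) q     ∎
  where open ≡-Reasoning

sumMin-saturated : ∀ D i p → D ≤ i → sumMin D i p ≡ p * D
sumMin-saturated D i zero    _   = refl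
sumMin-saturated D i (suc p) D≤i =
  cong₂ _+_ (m≥n⇒m⊓n≡n D≤i) (sumMin-saturated D (suc i) p (m≤n⇒m≤1+n D≤i))

suc-C2 : ∀ m → suc m C 2 ≡ m + m C 2
suc-C2 m = trans (sym (nCk+nC[k+1]≡[n+1]C[k+1] m 1)) (cong (_+ m C 2) (nC1≡n m))

sumMin-unsaturated : ∀ D i p → i + p ≤ D → i C 2 + sumMin D i p ≡ (i + p) C 2
sumMin-unsaturated D i zero    _ = trans (+-identityʳ (i C 2)) (cong (_C 2) (sym (+-identityʳ i)))
sumMin-unsaturated D i (suc p) i+p<D = begin
  i C 2 + (i ⊓ D + sumMin D (suc i) p)   ≡⟨ cong (λ m → i C 2 + (m + sumMin D (suc i) p)) (m≤n⇒m⊓n≡m i≤D) ⟩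
  i C 2 + (i + sumMin D (suc i) p)       ≡⟨ sym (+-assoc (i C 2) i _) ⟩
  i C 2 + i + sumMin D (suc i) p         ≡⟨ cong (_+ sumMin D (suc i) p) (trans (+-comm (i C 2) i) (sym (suc-C2 i))) ⟩
  suc i C 2 + sumMin D (suc i) p         ≡⟨ sumMin-unsaturated D (suc i) p (subst (_≤ D) (+-suc i p) i+p<D) ⟩
  (suc i + p) C 2                        ≡⟨ cong (_C 2) (sym (+-suc i p)) ⟩
  (i + suc p) C 2                        ∎
  where
  open ≡-Reasoning
  i≤D : i ≤ D
  i≤D = ≤-trans (m≤m+n i (suc p)) i+p<D

C2+suc-C2 : ∀ m → m C 2 + suc m C 2 ≡ m * m
C2+suc-C2 zero    = refl
C2+suc-C2 (suc m) = begin
  suc m C 2 + suc (suc m) C 2                 ≡⟨ cong₂ _+_ (suc-C2 m) (trans (suc-C2 (suc m)) (cong (suc m +_) (suc-C2 m))) ⟩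
  (m + m C 2) + (suc m + (m + m C 2))         ≡⟨ regroup m (m C 2) ⟩
  suc m + m + (m C 2 + (m + m C 2))           ≡⟨ cong (λ x → suc m + m + (m C 2 + x)) (sym (suc-C2 m)) ⟩
  suc m + m + (m C 2 + suc m C 2)             ≡⟨ cong (suc m + m +_) (C2+suc-C2 m) ⟩
  suc m + m + m * m                           ≡⟨ square m ⟩
  suc m * suc m                               ∎
  where
  open ≡-Reasoning
  regroup : ∀ m x → (m + x) + (suc m + (m + x)) ≡ suc m + m + (x + (m + x))
  regroup = solve-∀
  square : ∀ m → suc m + m + m * m ≡ suc m * suc m
  square = solve-∀

sumMin-closed : ∀ D n → D ≤ n → sumMin D 0 n ≡ n * D ∸ suc D C 2
sumMin-closed D n D≤n = begin
  sumMin D 0 n                              ≡⟨ cong (sumMin D 0) (sym D+t≡n) ⟩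
  sumMin D 0 (D + t)                        ≡⟨ sumMin-+ D 0 D t ⟩
  sumMin D 0 D + sumMin D D t               ≡⟨ cong₂ _+_ (sumMin-unsaturated D 0 D ≤-refl) (sumMin-saturated D D t ≤-refl) ⟩
  D C 2 + t * D                             ≡⟨ sym (m+n∸n≡m _ (suc D C 2)) ⟩
  D C 2 + t * D + suc D C 2 ∸ suc D C 2     ≡⟨ cong (_∸ suc D C 2) (regroup (D C 2) (t * D) (suc D C 2)) ⟩
  D C 2 + suc D C 2 + t * D ∸ suc D C 2     ≡⟨ cong (λ x → x + t * D ∸ suc D C 2) (C2+suc-C2 D) ⟩
  D * D + t * D ∸ suc D C 2                 ≡⟨ cong (_∸ suc D C 2) (sym (*-distribʳ-+ D D t)) ⟩
  (D + t) * D ∸ suc D C 2                   ≡⟨ cong (λ m → m * D ∸ suc D C 2) D+t≡n ⟩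
  n * D ∸ suc D C 2                         ∎
  where
  open ≡-Reasoning
  t : ℕ
  t = n ∸ D
  D+t≡n : D + t ≡ n
  D+t≡n = m+[n∸m]≡n D≤n
  regroup : ∀ a b c → a + b + c ≡ a + c + b
  regroup = solve-∀

module _ {a} {A : Set a} {k : ℕ} (c : A → Fin k) where
  Distinct : List A → Set a
  Distinct = AllPairs (λ x y → c x ≢ c y)

  Distinct-∈-injective : ∀ {R x y} → Distinct R → x ∈ R → y ∈ R → c x ≡ c y → x ≡ y
  Distinct-∈-injective (_  ∷ _) (here refl) (here refl) _   = refl
  Distinct-∈-injective (x≁ ∷ _) (here refl) (there y∈R) cx≡cy = contradiction cx≡cy (All.lookup x≁ y∈R)
  Distinct-∈-injective (y≁ ∷ _) (there x∈R) (here refl) cx≡cy = contradiction (sym cx≡cy) (All.lookup y≁ x∈R)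
  Distinct-∈-injective (_  ∷ d) (there x∈R) (there y∈R) cx≡cy = Distinct-∈-injective d x∈R y∈R cx≡cy

  Distinct-length≤ : ∀ {R} → Distinct R → length R ≤ k
  Distinct-length≤ d = injective⇒≤ (lookup-injective d)
    where
    lookup-injective : ∀ {R} → Distinct R → Injective _≡_ _≡_ (c ∘ lookup R)
    lookup-injective (_  ∷ _) {Fin.zero}  {Fin.zero}  _ = refl
    lookup-injective (x≁ ∷ _) {Fin.zero}  {Fin.suc j} e = contradiction e (All.lookup x≁ (∈-lookup j))
    lookup-injective (x≁ ∷ _) {Fin.suc i} {Fin.zero}  e = contradiction (sym e) (All.lookup x≁ (∈-lookup i))
    lookup-injective (_  ∷ d) {Fin.suc i} {Fin.suc j} e = cong Fin.suc (lookup-injective d e)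

  Distinct-covers : ∀ {R} → Distinct R → length R ≡ k → ∀ w → Any (λ r → c w ≡ c r) R
  Distinct-covers {R} d |R|≡k w with any? (λ r → c w Fin.≟ c r) R
  ... | yes w∼R = w∼R
  ... | no  w≁R = contradiction
    (subst (suc (length R) ≤_) (sym |R|≡k) (Distinct-length≤ (¬Any⇒All¬ R w≁R ∷ d))) 1+n≰n

module Learner {n : ℕ} (saturated : ℕ → Bool) where
  -- w is never a representative, but testing w ≟ r spares the invariant proving it.
  compare : Fin n → Fin n → Alg n → Alg n → Alg n
  compare w r same differ with w Fin.≟ r
  ... | yes _   = same
  ... | no  w≢r = ask w r w≢r (λ b → if b then same else differ)

  -- With b = true, w is known to lie in the cluster of some r ∈ R, so the last
  -- representative needs no query.
  scan : Bool → Fin n → List (Fin n) → (Maybe (Fin n) → Alg n) → Alg n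
  scan _     w []            k = k nothing
  scan true  w (r ∷ [])      k = k (just r)
  scan true  w (r ∷ r′ ∷ rs) k = compare w r (k (just r)) (scan true w (r′ ∷ rs) k)
  scan false w (r ∷ rs)      k = compare w r (k (just r)) (scan false w rs k)

  -- R holds one representative per cluster found so far, f maps each processed
  -- element to its representative, and saturated (length R) signals that R
  -- already meets every cluster.
  learnFrom : List (Fin n) → (Fin n → Fin n) → List (Fin n) → Alg n
  learnFrom R f []       = done f
  learnFrom R f (w ∷ ws) = scan (saturated (length R)) w R
    (maybe′ (λ r → learnFrom R (updateAt f w (const r)) ws)
            (learnFrom (w ∷ R) (updateAt f w (const w)) ws))

  learner : Alg n
  learner = learnFrom [] id (allFin n)

scanCost : Bool → ℕ → ℕ
scanCost true  j = j ∸ 1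
scanCost false j = j

scanCost-≤ : ∀ b j → scanCost b j ≤ j
scanCost-≤ true  j = m∸n≤m j 1
scanCost-≤ false j = ≤-refl

module LearnerSolves {n k} (c : Fin n → Fin k) (saturated : ℕ → Bool) (D : ℕ)
  (saturated-sound : ∀ j → T (saturated j) → j ≡ k)
  (scanCost-bounded : ∀ j → j ≤ k → scanCost (saturated j) j ≤ D) where
  open Learner {n} saturated

  compare-solves : ∀ w r (same differ : Alg n) q →
    (c w ≡ c r → Solves c zero q same) → (c w ≢ c r → Solves c zero q differ) →
    Solves c zero (suc q) (compare w r same differ)
  compare-solves w r same differ q same-solves differ-solves with w Fin.≟ r
  ... | yes refl = Solves-mono c same (n≤1+n q) (same-solves refl)
  ... | no  _    with c w Fin.≟ c r
  ...   | yes w∼r = same-solves w∼r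
  ...   | no  w≁r = differ-solves w≁r

  scan-solves : ∀ b w R (k : Maybe (Fin n) → Alg n) q → (T b → Any (λ r → c w ≡ c r) R) →
    (∀ {r} → r ∈ R → c w ≡ c r → Solves c zero q (k (just r))) →
    (All (λ r → c w ≢ c r) R → Solves c zero q (k nothing)) →
    Solves c zero (scanCost b (length R) + q) (scan b w R k)
  scan-solves true  w []            k q _       _     new = new []
  scan-solves false w []            k q _       _     new = new []
  scan-solves true  w (r ∷ [])      k q covered found _   =
    found (here refl) (singleton⁻ (covered _))
  scan-solves true  w (r ∷ r′ ∷ rs) k q covered found new =
    compare-solves w r (k (just r)) (scan true w (r′ ∷ rs) k) (length rs + q)
      (Solves-mono c (k (just r)) (m≤n+m q (length rs)) ∘ found (here refl)) λ w≁r →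
      scan-solves true w (r′ ∷ rs) k q (Any.tail w≁r ∘ covered)
        (λ r∈rs → found (there r∈rs)) (λ w≁rs → new (w≁r ∷ w≁rs))
  scan-solves false w (r ∷ rs)      k q _       found new =
    compare-solves w r (k (just r)) (scan false w rs k) (length rs + q)
      (Solves-mono c (k (just r)) (m≤n+m q (length rs)) ∘ found (here refl)) λ w≁r →
      scan-solves false w rs k q (λ ())
        (λ r∈rs → found (there r∈rs)) (λ w≁rs → new (w≁r ∷ w≁rs))

  Represented : (Fin n → Fin n) → List (Fin n) → Fin n → Set
  Represented f R x = f x ∈ R × c (f x) ≡ c x

  RepresentedExcept : List (Fin n) → (Fin n → Fin n) → List (Fin n) → Set
  RepresentedExcept ws f R = ∀ x → x ∈ ws ⊎ Represented f R x

  RepresentedExcept-assign : ∀ {w ws f R R′ r} → RepresentedExcept (w ∷ ws) f R →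
    R ⊆ R′ → r ∈ R′ → c r ≡ c w → RepresentedExcept ws (updateAt f w (const r)) R′
  RepresentedExcept-assign {w} {f = f} {r = r} inv R⊆R′ r∈R′ r∼w x with x Fin.≟ w | inv x
  ... | yes refl | _ rewrite updateAt-updates x {const r} f = inj₂ (r∈R′ , r∼w)
  ... | no  x≢w | inj₁ (here x≡w)    = contradiction x≡w x≢w
  ... | no  x≢w | inj₁ (there x∈ws)  = inj₁ x∈ws
  ... | no  x≢w | inj₂ (fx∈R , fx∼x) rewrite updateAt-minimal x w {const r} f x≢w =
    inj₂ (R⊆R′ fx∈R , fx∼x)

  Represented⇒Recovers : ∀ {f R} → Distinct c R → (∀ x → Represented f R x) → Recovers c f
  Represented⇒Recovers d rep u v with rep u | rep v
  ... | fu∈R , fu∼u | fv∈R , fv∼v = mk⇔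
    (λ fu≡fv → trans (sym fu∼u) (trans (cong c fu≡fv) fv∼v))
    (λ cu≡cv → Distinct-∈-injective c d fu∈R fv∈R (trans fu∼u (trans cu≡cv (sym fv∼v))))

  learnFrom-solves : ∀ ws i R f → length R ≤ i → Distinct c R → RepresentedExcept ws f R →
    Solves c zero (sumMin D i (length ws)) (learnFrom R f ws)
  learnFrom-solves []       i R f _     d inv = Represented⇒Recovers d (λ x → [ (λ ()) , id ]′ (inv x))
  learnFrom-solves (w ∷ ws) i R f |R|≤i d inv =
    Solves-mono c (scan b w R next) (+-monoˡ-≤ q cost≤)
      (scan-solves b w R next q (λ sat → Distinct-covers c d (saturated-sound _ sat) w) found new)
    where
    b : Bool
    b = saturated (length R)
    q : ℕ
    q = sumMin D (suc i) (length ws)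
    next : Maybe (Fin n) → Alg n
    next = maybe′ (λ r → learnFrom R (updateAt f w (const r)) ws)
                  (learnFrom (w ∷ R) (updateAt f w (const w)) ws)
    found : ∀ {r} → r ∈ R → c w ≡ c r → Solves c zero q (next (just r))
    found r∈R w∼r = learnFrom-solves ws (suc i) R _ (m≤n⇒m≤1+n |R|≤i) d
      (RepresentedExcept-assign inv id r∈R (sym w∼r))
    new : All (λ r → c w ≢ c r) R → Solves c zero q (next nothing)
    new w≁R = learnFrom-solves ws (suc i) (w ∷ R) _ (s≤s |R|≤i) (w≁R ∷ d)
      (RepresentedExcept-assign inv there (here refl) refl)
    cost≤ : scanCost b (length R) ≤ i ⊓ D
    cost≤ = ⊓-glb (≤-trans (scanCost-≤ b (length R)) |R|≤i)
                  (scanCost-bounded (length R) (Distinct-length≤ c d))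

  learner-solves : Solves c zero (sumMin D 0 n) learner
  learner-solves = subst (λ p → Solves c zero (sumMin D 0 p) learner) (length-tabulate {n = n} id)
    (learnFrom-solves (allFin n) 0 [] id z≤n [] (λ x → inj₁ (∈-allFin x)))

robust-learner-solves : ∀ {n k} ℓ D (c : Fin n → Fin k) (saturated : ℕ → Bool) →
  (∀ j → T (saturated j) → j ≡ k) → (∀ j → j ≤ k → scanCost (saturated j) j ≤ D) → D ≤ n →
  Solves c ℓ ((ℓ + 1) * (n * D ∸ suc D C 2) + ℓ) (robust ℓ (Learner.learner saturated))
robust-learner-solves {n} ℓ D c saturated sound bounded D≤n =
  subst (λ P → Solves c ℓ ((ℓ + 1) * P + ℓ) (robust ℓ (Learner.learner saturated)))
    (sumMin-closed D n D≤n)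
    (robust-solves c (Learner.learner saturated) _ ℓ ℓ
      (LearnerSolves.learner-solves c saturated D sound bounded) ≤-refl)

proposition1 : (n k ℓ : ℕ) → 1 ≤ k → k ≤ n →
    (∃[ A ] ((c : Fin n → Fin k) → IsPartitionInto n k c →
        Solves c ℓ ((ℓ + 1) * (n * (k ∸ 1) ∸ (k C 2)) + ℓ) A))
    ×
    (∃[ A ] ((k′ : ℕ) → 1 ≤ k′ → k′ ≤ n → (c : Fin n → Fin k′) → IsPartitionInto n k′ c →
        Solves c ℓ ((ℓ + 1) * (n * k′ ∸ ((k′ + 1) C 2)) + ℓ) A))
proposition1 n (suc k) ℓ (s≤s z≤n) k<n =
  (robust ℓ (Learner.learner known-saturated) , λ c _ →
     robust-learner-solves ℓ k c known-saturated (λ _ → toWitness) known-cost (≤-trans (n≤1+n k) k<n)) ,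
  (robust ℓ (Learner.learner (const false)) , λ k′ _ k′≤n c _ →
     subst (λ m → Solves c ℓ ((ℓ + 1) * (n * k′ ∸ m C 2) + ℓ) (robust ℓ (Learner.learner (const false))))
       (+-comm 1 k′) (robust-learner-solves ℓ k′ c (const false) (λ _ ()) (λ _ j≤k′ → j≤k′) k′≤n))
  where
  known-saturated : ℕ → Bool
  known-saturated j = ⌊ j ≟ suc k ⌋
  known-cost : ∀ j → j ≤ suc k → scanCost (known-saturated j) j ≤ k
  known-cost j j≤1+k with j ≟ suc k
  ... | yes refl = ≤-refl
  ... | no  j≢1+k = ≤-pred (≤∧≢⇒< j≤1+k j≢1+k)
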